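{- Let $S=\langle d_0,d_1,d_2,d_3\rangle$ be a numerical semigroup with embedding dimension four, and suppose $a_{11}=b_{11}$ and $a_{22}d_2=a_{33}d_3$. Let $R$ be the collection of all cubes of the initial collection whose labels lie in $\mathrm{Ap}(S,d_0)$, and delete from $R$ every cube $[[i,j,k]]$ with $k\ge a_{33}$. Then the resulting collection is an $L$-shape.
   Context: $S=\langle d_0,\dots,d_3\rangle$ is the set of nonnegative integer combinations of its minimal generators $d_0,\dots,d_3$ (with $\gcd=1$); $\mathrm{Ap}(S,d_0)=\{s\in S:s-d_0\notin S\}$. For $(i,j,k)\in\mathbb N^3$ the cube $[[i,j,k]]=[i,i+1]\times[j,j+1]\times[k,k+1]$ is labeled $id_1+jd_2+kd_3$; the initial collection is the set of all these cubes. For $i\in\{1,2,3\}$, $a_{ii}$ is the least positive integer with $a_{ii}d_i=\sum_{j\ne i}a_{ij}d_j$ for some $a_{ij}\in\mathbb N$, and $b_{ii}$ the least positive integer with $b_{ii}d_i=\sum_{j\ne i}b_{ij}d_j$ for some $b_{ij}\in\mathbb N$ with $b_{i0}>0$. An $L$-shape is a subset of the initial collection such that: all its labels lie in $\mathrm{Ap}(S,d_0)$; every element of $\mathrm{Ap}(S,d_0)$ labels exactly one of its cubes; and whenever a cube $[[a,b,c]]$ is not in it, no cube $[[i,j,k]]$ with $i\ge a,j\ge b,k\ge c$ is in it. -}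

module Defs where

open import Data.Nat using (ℕ; _+_; _*_; _≤_; _<_)
open import Data.Nat.GCD using (gcd)
open import Data.Product using (Σ; ∃; _×_)
open import Relation.Binary.PropositionalEquality using (_≡_)
open import Relation.Nullary using (¬_)

Gen3 : ℕ → ℕ → ℕ → ℕ → Set
Gen3 a b c s = ∃ λ x → ∃ λ y → ∃ λ z → s ≡ x * a + y * b + z * c

InS : ℕ → ℕ → ℕ → ℕ → ℕ → Set
InS d0 d1 d2 d3 s =
  ∃ λ x0 → ∃ λ x1 → ∃ λ x2 → ∃ λ x3 → s ≡ x0 * d0 + x1 * d1 + x2 * d2 + x3 * d3

-- d0,…,d3 are the (four distinct) minimal generators of a numerical semigroup:
-- positive, gcd 1, and none lies in the semigroup generated by the other three.
-- (Hence the embedding dimension is four.)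
NumSemigroupEmbDim4 : ℕ → ℕ → ℕ → ℕ → Set
NumSemigroupEmbDim4 d0 d1 d2 d3 =
  (0 < d0 × 0 < d1 × 0 < d2 × 0 < d3)
  × gcd (gcd d0 d1) (gcd d2 d3) ≡ 1
  × ¬ Gen3 d1 d2 d3 d0 × ¬ Gen3 d0 d2 d3 d1
  × ¬ Gen3 d0 d1 d3 d2 × ¬ Gen3 d0 d1 d2 d3

InAp : ℕ → ℕ → ℕ → ℕ → ℕ → Set
InAp d0 d1 d2 d3 s =
  InS d0 d1 d2 d3 s × ¬ (Σ ℕ λ t → InS d0 d1 d2 d3 t × s ≡ t + d0)

LeastPos : (ℕ → Set) → ℕ → Set
LeastPos P n = 0 < n × P n × (∀ m → 0 < m → P m → n ≤ m)

IsA11 : ℕ → ℕ → ℕ → ℕ → ℕ → Set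
IsA11 d0 d1 d2 d3 = LeastPos λ n →
  ∃ λ a0 → ∃ λ a2 → ∃ λ a3 → n * d1 ≡ a0 * d0 + a2 * d2 + a3 * d3

IsB11 : ℕ → ℕ → ℕ → ℕ → ℕ → Set
IsB11 d0 d1 d2 d3 = LeastPos λ n →
  ∃ λ b0 → ∃ λ b2 → ∃ λ b3 → 0 < b0 × n * d1 ≡ b0 * d0 + b2 * d2 + b3 * d3

IsA22 : ℕ → ℕ → ℕ → ℕ → ℕ → Set
IsA22 d0 d1 d2 d3 = LeastPos λ n →
  ∃ λ a0 → ∃ λ a1 → ∃ λ a3 → n * d2 ≡ a0 * d0 + a1 * d1 + a3 * d3

IsA33 : ℕ → ℕ → ℕ → ℕ → ℕ → Set
IsA33 d0 d1 d2 d3 = LeastPos λ n →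
  ∃ λ a0 → ∃ λ a1 → ∃ λ a2 → n * d3 ≡ a0 * d0 + a1 * d1 + a2 * d2

label : ℕ → ℕ → ℕ → ℕ → ℕ → ℕ → ℕ
label d1 d2 d3 i j k = i * d1 + j * d2 + k * d3

-- a collection of cubes = a predicate on ℕ³ (cube [[i,j,k]] ↦ (i,j,k))
Collection : Set₁
Collection = ℕ → ℕ → ℕ → Set

IsLShape : ℕ → ℕ → ℕ → ℕ → Collection → Set
IsLShape d0 d1 d2 d3 C =
  (∀ i j k → C i j k → InAp d0 d1 d2 d3 (label d1 d2 d3 i j k))
  × (∀ s → InAp d0 d1 d2 d3 s →
       (∃ λ i → ∃ λ j → ∃ λ k → C i j k × label d1 d2 d3 i j k ≡ s)
       × (∀ i j k i' j' k' → C i j k → label d1 d2 d3 i j k ≡ s →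
            C i' j' k' → label d1 d2 d3 i' j' k' ≡ s →
            i ≡ i' × j ≡ j' × k ≡ k'))
  × (∀ a b c → ¬ C a b c → ∀ i j k → a ≤ i → b ≤ j → c ≤ k → ¬ C i j k)

RTrunc : ℕ → ℕ → ℕ → ℕ → ℕ → Collection
RTrunc d0 d1 d2 d3 a33 i j k = InAp d0 d1 d2 d3 (label d1 d2 d3 i j k) × k < a33

-- Ap(S,d0) is closed under summands lying in S, so the truncated collection is closed downwards;
-- and since a11 = b11, a cube with i ≥ a11 has its label in d0 + S, so every cube of R has i < a11.
-- An Apéry element has no d0 in any representation, and a33 d3 = a22 d2 moves its d3-coordinate
-- below a33, which gives a covering cube. For uniqueness, cancel the common part of two cubes with the
-- same label: the remaining coordinates have disjoint supports, and each remaining relation among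
-- d1, d2, d3 contradicts the minimality of a11 or a33, or (through a22 d2 = a33 d3) of a22 and a11.
module Submission where

open import Defs
open import Data.Nat using (ℕ; zero; suc; _+_; _*_; _≤_; _<_; _≤?_; NonZero; z<s; >-nonZero)
open import Data.Nat.Properties
  using (+-identityʳ; +-comm; +-cancelˡ-≡; m+n≡0⇒m≡0; m+n≡0⇒n≡0; m*n≡0⇒m≡0;
         m≤n⇒∃[o]m+o≡n; m≤n+m; 1+n≢0; ≤-<-trans; <⇒≱; ≰⇒>; +-commutativeSemigroup)
open import Algebra.Properties.CommutativeSemigroup +-commutativeSemigroup using (xy∙z≈xz∙y)
open import Data.Nat.DivMod using (_/_; _%_; m≡m%n+[m/n]*n; m%n<n)
open import Data.Nat.Tactic.RingSolver using (solve)
open import Data.List using ([]; _∷_)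
open import Data.Product using (∃; _×_; _,_; proj₁; proj₂; map)
open import Data.Sum using (_⊎_; inj₁; inj₂; swap)
open import Data.Empty using (⊥-elim)
open import Function using (_∘_)
open import Relation.Nullary using (¬_; yes; no)
open import Relation.Binary.PropositionalEquality
  using (_≡_; refl; sym; trans; cong; subst; module ≡-Reasoning)

split-at-min : ∀ m n → ∃ λ c → ∃ λ a → ∃ λ b → m ≡ c + a × n ≡ c + b × (a ≡ 0 ⊎ b ≡ 0)
split-at-min zero    n       = 0 , 0 , n , refl , refl , inj₁ refl
split-at-min (suc m) zero    = 0 , suc m , 0 , refl , refl , inj₂ refl
split-at-min (suc m) (suc n) with split-at-min m n
... | c , a , b , m≡c+a , n≡c+b , a∨b = suc c , a , b , cong suc m≡c+a , cong suc n≡c+b , a∨b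

module Apéry (d0 d1 d2 d3 : ℕ) where

  open ≡-Reasoning

  S Ap : ℕ → Set
  S  = InS d0 d1 d2 d3
  Ap = InAp d0 d1 d2 d3

  lab : ℕ → ℕ → ℕ → ℕ
  lab = label d1 d2 d3

  Trunc : ℕ → Collection
  Trunc = RTrunc d0 d1 d2 d3

  InS-+ : ∀ {s t} → S s → S t → S (s + t)
  InS-+ (x0 , x1 , x2 , x3 , refl) (y0 , y1 , y2 , y3 , refl) =
    x0 + y0 , x1 + y1 , x2 + y2 , x3 + y3 ,
    solve (x0 ∷ x1 ∷ x2 ∷ x3 ∷ y0 ∷ y1 ∷ y2 ∷ y3 ∷ d0 ∷ d1 ∷ d2 ∷ d3 ∷ [])

  label∈S : ∀ i j k → S (lab i j k)
  label∈S i j k = 0 , i , j , k , refl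

  label-+ : ∀ i j k i' j' k' →
    (i + i') * d1 + (j + j') * d2 + (k + k') * d3
      ≡ (i * d1 + j * d2 + k * d3) + (i' * d1 + j' * d2 + k' * d3)
  label-+ i j k i' j' k' = solve (i ∷ j ∷ k ∷ i' ∷ j' ∷ k' ∷ d1 ∷ d2 ∷ d3 ∷ [])

  InAp-+⁻ˡ : ∀ {s t} → S s → S t → Ap (s + t) → Ap s
  InAp-+⁻ˡ {s} {t} s∈S t∈S (_ , s+t∉d0+S) = s∈S , λ (u , u∈S , s≡u+d0) →
    s+t∉d0+S (u + t , InS-+ u∈S t∈S , trans (cong (_+ t) s≡u+d0) (xy∙z≈xz∙y u d0 t))

  label-InAp-mono : ∀ {a b c i j k} → a ≤ i → b ≤ j → c ≤ k → Ap (lab i j k) → Ap (lab a b c)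
  label-InAp-mono {a} {b} {c} a≤i b≤j c≤k ap
    with m≤n⇒∃[o]m+o≡n a≤i | m≤n⇒∃[o]m+o≡n b≤j | m≤n⇒∃[o]m+o≡n c≤k
  ... | p , refl | q , refl | r , refl =
    InAp-+⁻ˡ (label∈S a b c) (label∈S p q r) (subst Ap (label-+ a b c p q r) ap)

  positive-d0-coefficient⇒∉Ap : ∀ x0 x1 x2 x3 → ¬ Ap (suc x0 * d0 + x1 * d1 + x2 * d2 + x3 * d3)
  positive-d0-coefficient⇒∉Ap x0 x1 x2 x3 (_ , ∉d0+S) =
    ∉d0+S (x0 * d0 + x1 * d1 + x2 * d2 + x3 * d3 , (x0 , x1 , x2 , x3 , refl) ,
           solve (x0 ∷ x1 ∷ x2 ∷ x3 ∷ d0 ∷ d1 ∷ d2 ∷ d3 ∷ []))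

  InAp⇒label : ∀ {s} → Ap s → ∃ λ i → ∃ λ j → ∃ λ k → lab i j k ≡ s
  InAp⇒label ((zero , i , j , k , s≡) , _) = i , j , k , sym s≡
  InAp⇒label s∈Ap@((suc x0 , x1 , x2 , x3 , refl) , _) =
    ⊥-elim (positive-d0-coefficient⇒∉Ap x0 x1 x2 x3 s∈Ap)

  label∈Ap⇒i<b11 : ∀ {b11} → IsB11 d0 d1 d2 d3 b11 → ∀ i j k → Ap (lab i j k) → i < b11
  label∈Ap⇒i<b11 {b11} (_ , (suc c , b2 , b3 , _ , b11d1≡) , _) i j k ap with b11 ≤? i
  ... | no b11≰i = ≰⇒> b11≰i
  ... | yes b11≤i with m≤n⇒∃[o]m+o≡n b11≤i
  ...   | p , refl = ⊥-elim (positive-d0-coefficient⇒∉Ap c p (b2 + j) (b3 + k) (subst Ap label≡ ap))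
    where
      label≡ : lab (b11 + p) j k ≡ (1 + c) * d0 + p * d1 + (b2 + j) * d2 + (b3 + k) * d3
      label≡ = begin
        (b11 + p) * d1 + j * d2 + k * d3
          ≡⟨ solve (b11 ∷ p ∷ j ∷ k ∷ d1 ∷ d2 ∷ d3 ∷ []) ⟩
        b11 * d1 + (p * d1 + j * d2 + k * d3)
          ≡⟨ cong (_+ (p * d1 + j * d2 + k * d3)) b11d1≡ ⟩
        (1 + c) * d0 + b2 * d2 + b3 * d3 + (p * d1 + j * d2 + k * d3)
          ≡⟨ solve (c ∷ b2 ∷ b3 ∷ p ∷ j ∷ k ∷ d0 ∷ d1 ∷ d2 ∷ d3 ∷ []) ⟩
        (1 + c) * d0 + p * d1 + (b2 + j) * d2 + (b3 + k) * d3 ∎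

  label-shift : ∀ {m n} → m * d2 ≡ n * d3 → ∀ i j q r → lab i j (r + q * n) ≡ lab i (j + q * m) r
  label-shift {m} {n} md2≡nd3 i j q r = begin
    i * d1 + j * d2 + (r + q * n) * d3     ≡⟨ solve (i ∷ j ∷ q ∷ r ∷ n ∷ d1 ∷ d2 ∷ d3 ∷ []) ⟩
    i * d1 + j * d2 + r * d3 + q * (n * d3) ≡⟨ cong (λ x → i * d1 + j * d2 + r * d3 + q * x) (sym md2≡nd3) ⟩
    i * d1 + j * d2 + r * d3 + q * (m * d2) ≡⟨ solve (i ∷ j ∷ q ∷ r ∷ m ∷ d1 ∷ d2 ∷ d3 ∷ []) ⟩
    i * d1 + (j + q * m) * d2 + r * d3     ∎

  Trunc-covers-Ap : ∀ {m n s} .{{_ : NonZero n}} → m * d2 ≡ n * d3 → Ap s →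
    ∃ λ i → ∃ λ j → ∃ λ k → Trunc n i j k × lab i j k ≡ s
  Trunc-covers-Ap {m} {n} md2≡nd3 s∈Ap with InAp⇒label s∈Ap
  ... | i , j , k , refl =
    i , j + (k / n) * m , k % n , (subst Ap reduce s∈Ap , m%n<n k n) , sym reduce
    where
      reduce : lab i j k ≡ lab i (j + (k / n) * m) (k % n)
      reduce = trans (cong (lab i j) (m≡m%n+[m/n]*n k n)) (label-shift md2≡nd3 i j (k / n) (k % n))

  Trunc-downward-closed : ∀ {n a b c i j k} → a ≤ i → b ≤ j → c ≤ k → Trunc n i j k → Trunc n a b c
  Trunc-downward-closed a≤i b≤j c≤k (ap , k<n) = label-InAp-mono a≤i b≤j c≤k ap , ≤-<-trans c≤k k<n

  i*d1≡j*d2+k*d3⇒i≡0 : ∀ {a11} → IsA11 d0 d1 d2 d3 a11 →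
    ∀ i j k → i < a11 → i * d1 ≡ j * d2 + k * d3 → i ≡ 0
  i*d1≡j*d2+k*d3⇒i≡0 _                 zero    _ _ _     _ = refl
  i*d1≡j*d2+k*d3⇒i≡0 (_ , _ , a11-min) (suc i) j k i<a11 e =
    ⊥-elim (<⇒≱ i<a11 (a11-min (suc i) z<s (0 , j , k , e)))

  i*d1+j*d2≡k*d3⇒k≡0 : ∀ {a33} → IsA33 d0 d1 d2 d3 a33 →
    ∀ i j k → k < a33 → i * d1 + j * d2 ≡ k * d3 → k ≡ 0
  i*d1+j*d2≡k*d3⇒k≡0 _                 _ _ zero    _     _ = refl
  i*d1+j*d2≡k*d3⇒k≡0 (_ , _ , a33-min) i j (suc k) k<a33 e =
    ⊥-elim (<⇒≱ k<a33 (a33-min (suc k) z<s (0 , i , j , sym e)))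

  module _ {{_ : NonZero d1}} {{_ : NonZero d2}} {{_ : NonZero d3}} where

    label≡0⇒ : ∀ i j k → lab i j k ≡ 0 → i ≡ 0 × j ≡ 0 × k ≡ 0
    label≡0⇒ i j k e =
      m*n≡0⇒m≡0 i d1 (m+n≡0⇒m≡0 (i * d1) (m+n≡0⇒m≡0 (i * d1 + j * d2) e)) ,
      m*n≡0⇒m≡0 j d2 (m+n≡0⇒n≡0 (i * d1) (m+n≡0⇒m≡0 (i * d1 + j * d2) e)) ,
      m*n≡0⇒m≡0 k d3 (m+n≡0⇒n≡0 (i * d1 + j * d2) e)

    -- j = a22 + p and a33 = 1 + k + q turn the relation into i d1 = p d2 + (1 + q) d3,
    -- which forces i = 0 and then the impossible 0 = p d2 + (1 + q) d3.
    i*d1+k*d3≡j*d2⇒j≡0 : ∀ {a11 a22 a33} → IsA11 d0 d1 d2 d3 a11 → IsA22 d0 d1 d2 d3 a22 →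
      a22 * d2 ≡ a33 * d3 → ∀ i j k → i < a11 → k < a33 → i * d1 + k * d3 ≡ j * d2 → j ≡ 0
    i*d1+k*d3≡j*d2⇒j≡0 _ _ _ _ zero _ _ _ _ = refl
    i*d1+k*d3≡j*d2⇒j≡0 {a22 = a22} {a33} A11 (_ , _ , a22-min) a22d2≡a33d3 i (suc j) k i<a11 k<a33 e
      with m≤n⇒∃[o]m+o≡n (a22-min (suc j) z<s (0 , i , k , sym e)) | m≤n⇒∃[o]m+o≡n k<a33
    ... | p , a22+p≡1+j | q , 1+k+q≡a33 =
      ⊥-elim (1+n≢0 (m*n≡0⇒m≡0 (suc q) d3 (m+n≡0⇒n≡0 (p * d2) (sym 0≡p*d2+[1+q]*d3))))
      where
        i*d1≡p*d2+[1+q]*d3 : i * d1 ≡ p * d2 + (1 + q) * d3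
        i*d1≡p*d2+[1+q]*d3 = +-cancelˡ-≡ (k * d3) _ _ (begin
          k * d3 + i * d1             ≡⟨ +-comm (k * d3) (i * d1) ⟩
          i * d1 + k * d3             ≡⟨ e ⟩
          suc j * d2                  ≡⟨ cong (_* d2) (sym a22+p≡1+j) ⟩
          (a22 + p) * d2              ≡⟨ solve (a22 ∷ p ∷ d2 ∷ []) ⟩
          a22 * d2 + p * d2           ≡⟨ cong (_+ p * d2) a22d2≡a33d3 ⟩
          a33 * d3 + p * d2           ≡⟨ cong (λ x → x * d3 + p * d2) (sym 1+k+q≡a33) ⟩
          (1 + k + q) * d3 + p * d2   ≡⟨ solve (k ∷ q ∷ p ∷ d2 ∷ d3 ∷ []) ⟩
          k * d3 + (p * d2 + (1 + q) * d3) ∎)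

        0≡p*d2+[1+q]*d3 : 0 ≡ p * d2 + (1 + q) * d3
        0≡p*d2+[1+q]*d3 =
          subst (λ x → x * d1 ≡ _)
            (i*d1≡j*d2+k*d3⇒i≡0 A11 i p (1 + q) i<a11 i*d1≡p*d2+[1+q]*d3) i*d1≡p*d2+[1+q]*d3

    module Uniqueness {a11 b11 a22 a33 : ℕ}
      (A11 : IsA11 d0 d1 d2 d3 a11) (B11 : IsB11 d0 d1 d2 d3 b11) (a11≡b11 : a11 ≡ b11)
      (A22 : IsA22 d0 d1 d2 d3 a22) (A33 : IsA33 d0 d1 d2 d3 a33) (a22d2≡a33d3 : a22 * d2 ≡ a33 * d3)
      where

      label-injective-disjoint₀ : ∀ {i j k j' k'} → i < a11 → k < a33 → k' < a33 →
        j ≡ 0 ⊎ j' ≡ 0 → k ≡ 0 ⊎ k' ≡ 0 → lab i j k ≡ lab 0 j' k' → i ≡ 0 × j ≡ j' × k ≡ k'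
      label-injective-disjoint₀ {i} {j} {k} _ _ _ (inj₂ refl) (inj₂ refl) e = label≡0⇒ i j k e
      label-injective-disjoint₀ {i} {j} {k' = k'} _ _ k'<a33 (inj₂ refl) (inj₁ refl) e
        with i*d1+j*d2≡k*d3⇒k≡0 A33 i j k' k'<a33 (trans (sym (+-identityʳ _)) e)
      ... | refl = label≡0⇒ i j 0 e
      label-injective-disjoint₀ {i} {k = k} {j'} i<a11 k<a33 _ (inj₁ refl) (inj₂ refl) e
        with i*d1+k*d3≡j*d2⇒j≡0 A11 A22 a22d2≡a33d3 i j' k i<a11 k<a33
               (trans (cong (_+ k * d3) (sym (+-identityʳ (i * d1)))) (trans e (+-identityʳ (j' * d2))))
      ... | refl = label≡0⇒ i 0 k e
      label-injective-disjoint₀ {i} {j' = j'} {k'} i<a11 _ _ (inj₁ refl) (inj₁ refl) e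
        with i*d1≡j*d2+k*d3⇒i≡0 A11 i j' k' i<a11
               (trans (sym (trans (+-identityʳ _) (+-identityʳ (i * d1)))) e)
      ... | refl = map sym (map sym sym) (label≡0⇒ 0 j' k' (sym e))

      label-injective-disjoint : ∀ {i j k i' j' k'} → i < a11 → i' < a11 → k < a33 → k' < a33 →
        i ≡ 0 ⊎ i' ≡ 0 → j ≡ 0 ⊎ j' ≡ 0 → k ≡ 0 ⊎ k' ≡ 0 → lab i j k ≡ lab i' j' k' →
        i ≡ i' × j ≡ j' × k ≡ k'
      label-injective-disjoint i<a11 _ k<a33 k'<a33 (inj₂ refl) j∨j' k∨k' e =
        label-injective-disjoint₀ i<a11 k<a33 k'<a33 j∨j' k∨k' e
      label-injective-disjoint _ i'<a11 k<a33 k'<a33 (inj₁ refl) j∨j' k∨k' e =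
        map sym (map sym sym)
          (label-injective-disjoint₀ i'<a11 k'<a33 k<a33 (swap j∨j') (swap k∨k') (sym e))

      label∈Ap⇒i<a11 : ∀ i j k → Ap (lab i j k) → i < a11
      label∈Ap⇒i<a11 i j k ap = subst (i <_) (sym a11≡b11) (label∈Ap⇒i<b11 B11 i j k ap)

      Trunc-label-injective : ∀ {i j k i' j' k'} → Trunc a33 i j k → Trunc a33 i' j' k' →
        lab i j k ≡ lab i' j' k' → i ≡ i' × j ≡ j' × k ≡ k'
      Trunc-label-injective {i} {j} {k} {i'} {j'} {k'} ap,k<a33 ap',k'<a33 e
        with split-at-min i i' | split-at-min j j' | split-at-min k k'
      ... | c1 , x1 , y1 , refl , refl , x1∨y1 | c2 , x2 , y2 , refl , refl , x2∨y2
          | c3 , x3 , y3 , refl , refl , x3∨y3 =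
        map (cong (c1 +_)) (map (cong (c2 +_)) (cong (c3 +_)))
          (label-injective-disjoint
            (label∈Ap⇒i<a11 x1 x2 x3 (proj₁ x∈Trunc)) (label∈Ap⇒i<a11 y1 y2 y3 (proj₁ y∈Trunc))
            (proj₂ x∈Trunc) (proj₂ y∈Trunc) x1∨y1 x2∨y2 x3∨y3
            (+-cancelˡ-≡ (lab c1 c2 c3) _ _
              (trans (sym (label-+ c1 c2 c3 x1 x2 x3)) (trans e (label-+ c1 c2 c3 y1 y2 y3)))))
        where
          x∈Trunc : Trunc a33 x1 x2 x3
          x∈Trunc = Trunc-downward-closed (m≤n+m x1 c1) (m≤n+m x2 c2) (m≤n+m x3 c3) ap,k<a33
          y∈Trunc : Trunc a33 y1 y2 y3
          y∈Trunc = Trunc-downward-closed (m≤n+m y1 c1) (m≤n+m y2 c2) (m≤n+m y3 c3) ap',k'<a33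

proposition2p8 : (d0 d1 d2 d3 a11 b11 a22 a33 : ℕ)
    → NumSemigroupEmbDim4 d0 d1 d2 d3
    → IsA11 d0 d1 d2 d3 a11 → IsB11 d0 d1 d2 d3 b11
    → IsA22 d0 d1 d2 d3 a22 → IsA33 d0 d1 d2 d3 a33
    → a11 ≡ b11 → a22 * d2 ≡ a33 * d3
    → IsLShape d0 d1 d2 d3 (RTrunc d0 d1 d2 d3 a33)
proposition2p8 d0 d1 d2 d3 a11 b11 a22 a33 ((_ , z<s , z<s , z<s) , _) A11 B11 A22 A33 a11≡b11 a22d2≡a33d3 =
    (λ _ _ _ → proj₁)
  , (λ _ s∈Ap → Trunc-covers-Ap {m = a22} {{>-nonZero (proj₁ A33)}} a22d2≡a33d3 s∈Ap
              , λ _ _ _ _ _ _ c e c' e' → Trunc-label-injective c c' (trans e (sym e')))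
  , λ _ _ _ ¬C _ _ _ a≤i b≤j c≤k → ¬C ∘ Trunc-downward-closed a≤i b≤j c≤k
  where
    open Apéry d0 d1 d2 d3
    open Uniqueness A11 B11 a11≡b11 A22 A33 a22d2≡a33d3
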